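{- Let $\mathsf{M}^s=\{\langle v,\mathfrak{R}\rangle:\mathfrak{R}\text{ is symmetric}\}$ and $\mathsf{M}^n=\{\langle v,\mathfrak{R}\rangle:\text{for all }\varphi,\psi\in\mathsf{FOR},\ \langle\neg\varphi,\psi\rangle\in\mathfrak{R}\Rightarrow\langle\varphi,\psi\rangle\in\mathfrak{R}\}$. Neither $\mathsf{M}^s$ nor $\mathsf{M}^n$ is definable.
   Context: Let $\Phi=\{p_0,p_1,\dots\}$ be a countably infinite set of propositional letters; $\mathsf{FOR}$ is the set of formulas built from $\Phi$ with $\neg$ and binary $\lor,\wedge,\to,\leftrightarrow,\vartriangle,\looparrowright$. An Epstein model is $\langle v,\mathfrak{R}\rangle$ with $v:\Phi\to\{0,1\}$ and $\mathfrak{R}\subseteq\mathsf{FOR}^2$. Truth: $\langle v,\mathfrak{R}\rangle\vDash p$ iff $v(p)=1$; classical clauses for $\neg,\wedge,\lor,\to,\leftrightarrow$; $\vDash\psi\vartriangle\chi$ iff both $\psi,\chi$ true and $\langle\psi,\chi\rangle\in\mathfrak{R}$; $\vDash\psi\looparrowright\chi$ iff ($\psi$ false or $\chi$ true) and $\langle\psi,\chi\rangle\in\mathfrak{R}$. A set $\mathsf{K}$ of Epstein models is definable iff there is $\Gamma\subseteq\mathsf{FOR}$ such that for every Epstein model $\mathfrak{M}$: $\mathfrak{M}\vDash\gamma$ for all $\gamma\in\Gamma$ iff $\mathfrak{M}\in\mathsf{K}$. -}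

module Defs where

open import Data.Nat using (ℕ)
open import Data.Bool using (Bool; true; false)
open import Data.Product using (Σ; _×_; _,_; ∃)
open import Data.Sum using (_⊎_)
open import Data.Empty using (⊥)
open import Relation.Nullary using (¬_)
open import Relation.Binary.PropositionalEquality using (_≡_)
open import Function.Bundles using (_⇔_)

data FOR : Set where
  var  : ℕ → FOR
  ¬'   : FOR → FOR
  _∨'_ : FOR → FOR → FOR
  _∧'_ : FOR → FOR → FOR
  _→'_ : FOR → FOR → FOR
  _↔'_ : FOR → FOR → FOR
  _△_  : FOR → FOR → FOR
  _↬_  : FOR → FOR → FOR

record Model : Set₁ where
  constructor ⟨_,_⟩
  field
    v : ℕ → Bool
    ℜ : FOR → FOR → Set

open Model public

_⊨_ : Model → FOR → Set
M ⊨ var p   = v M p ≡ true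
M ⊨ ¬' φ    = ¬ (M ⊨ φ)
M ⊨ (φ ∨' ψ) = (M ⊨ φ) ⊎ (M ⊨ ψ)
M ⊨ (φ ∧' ψ) = (M ⊨ φ) × (M ⊨ ψ)
M ⊨ (φ →' ψ) = M ⊨ φ → M ⊨ ψ
M ⊨ (φ ↔' ψ) = (M ⊨ φ → M ⊨ ψ) × (M ⊨ ψ → M ⊨ φ)
M ⊨ (φ △ ψ)  = ((M ⊨ φ) × (M ⊨ ψ)) × ℜ M φ ψ
M ⊨ (φ ↬ ψ)  = (¬ (M ⊨ φ) ⊎ (M ⊨ ψ)) × ℜ M φ ψ

ModelClass : Set₁
ModelClass = Model → Set

Definable : ModelClass → Set₁
Definable K = Σ (FOR → Set) λ Γ →
  (M : Model) → ((γ : FOR) → Γ γ → M ⊨ γ) ⇔ K M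

Ms : ModelClass
Ms M = (φ ψ : FOR) → ℜ M φ ψ → ℜ M ψ φ

Mn : ModelClass
Mn M = (φ ψ : FOR) → ℜ M (¬' φ) ψ → ℜ M φ ψ

-- Adding to the empty relation the single pair ⟨¬p₀, p₀⟩ changes the truth of no formula
-- as long as p₀ is false: ¬p₀ △ p₀ needs p₀ true, and ¬p₀ ↬ p₀ needs ¬p₀ false or p₀ true.
-- The empty relation is symmetric and in Mⁿ, while the one-pair relation is neither
-- symmetric nor in Mⁿ (⟨p₀, p₀⟩ is missing), so no set of formulas separates the two models.
module Submission where

open import Defs
open import Data.Nat using (ℕ)
open import Data.Bool using (Bool; false)
open import Data.Product using (_×_; _,_)
open import Data.Sum using (inj₁; inj₂)
open import Data.Empty using (⊥)
open import Relation.Nullary using (¬_)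
open import Relation.Binary.PropositionalEquality using (_≡_; refl; trans; sym)
open import Function.Bundles using (Equivalence)

_≡ᴱ_ : Model → Model → Set
M ≡ᴱ N = ∀ φ → (M ⊨ φ → N ⊨ φ) × (N ⊨ φ → M ⊨ φ)

definable-invariant : ∀ {K} → Definable K → ∀ {M N} → M ≡ᴱ N → K M → K N
definable-invariant (Γ , defines) {M} {N} M≡N KM =
  Equivalence.to (defines N) λ γ γ∈Γ →
    let (M⇒N , _) = M≡N γ in M⇒N (Equivalence.from (defines M) KM γ γ∈Γ)

not-definable : ∀ {K M N} → M ≡ᴱ N → K M → ¬ K N → ¬ Definable K
not-definable M≡N KM ¬KN def = ¬KN (definable-invariant def M≡N KM)

p₀ : FOR
p₀ = var 0

∅ : FOR → FOR → Set
∅ _ _ = ⊥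

only-¬p₀-p₀ : FOR → FOR → Set
only-¬p₀-p₀ φ ψ = φ ≡ ¬' p₀ × ψ ≡ p₀

module _ (v : ℕ → Bool) (p₀-false : v 0 ≡ false) where

  private
    E S : Model
    E = ⟨ v , ∅ ⟩
    S = ⟨ v , only-¬p₀-p₀ ⟩

    p₀-fails : ¬ (S ⊨ p₀)
    p₀-fails p₀-true with trans (sym p₀-true) p₀-false
    ... | ()

    E⇒S : ∀ φ → E ⊨ φ → S ⊨ φ
    S⇒E : ∀ φ → S ⊨ φ → E ⊨ φ

    E⇒S (var x) h = h
    E⇒S (¬' φ) h s = h (S⇒E φ s)
    E⇒S (φ ∨' ψ) (inj₁ h) = inj₁ (E⇒S φ h)
    E⇒S (φ ∨' ψ) (inj₂ h) = inj₂ (E⇒S ψ h)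
    E⇒S (φ ∧' ψ) (a , b) = E⇒S φ a , E⇒S ψ b
    E⇒S (φ →' ψ) h s = E⇒S ψ (h (S⇒E φ s))
    E⇒S (φ ↔' ψ) (a , b) = (λ s → E⇒S ψ (a (S⇒E φ s))) , (λ s → E⇒S φ (b (S⇒E ψ s)))
    E⇒S (φ △ ψ) (_ , ())
    E⇒S (φ ↬ ψ) (_ , ())

    S⇒E (var x) h = h
    S⇒E (¬' φ) h e = h (E⇒S φ e)
    S⇒E (φ ∨' ψ) (inj₁ h) = inj₁ (S⇒E φ h)
    S⇒E (φ ∨' ψ) (inj₂ h) = inj₂ (S⇒E ψ h)
    S⇒E (φ ∧' ψ) (a , b) = S⇒E φ a , S⇒E ψ b
    S⇒E (φ →' ψ) h e = S⇒E ψ (h (E⇒S φ e))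
    S⇒E (φ ↔' ψ) (a , b) = (λ e → S⇒E ψ (a (E⇒S φ e))) , (λ e → S⇒E φ (b (E⇒S ψ e)))
    S⇒E (.(¬' p₀) △ .p₀) ((_ , p₀-true) , refl , refl) with p₀-fails p₀-true
    ... | ()
    S⇒E (.(¬' p₀) ↬ .p₀) (inj₁ ¬¬p₀ , refl , refl) with ¬¬p₀ p₀-fails
    ... | ()
    S⇒E (.(¬' p₀) ↬ .p₀) (inj₂ p₀-true , refl , refl) with p₀-fails p₀-true
    ... | ()

  adding-¬p₀-p₀-invisible : ⟨ v , ∅ ⟩ ≡ᴱ ⟨ v , only-¬p₀-p₀ ⟩
  adding-¬p₀-p₀-invisible φ = E⇒S φ , S⇒E φ

only-¬p₀-p₀-not-symmetric : ¬ Ms ⟨ (λ _ → false) , only-¬p₀-p₀ ⟩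
only-¬p₀-p₀-not-symmetric symmetric with symmetric (¬' p₀) p₀ (refl , refl)
... | () , _

only-¬p₀-p₀-not-Mn : ¬ Mn ⟨ (λ _ → false) , only-¬p₀-p₀ ⟩
only-¬p₀-p₀-not-Mn closed with closed p₀ p₀ (refl , refl)
... | () , _

mainTheorem18 : ¬ Definable Ms × ¬ Definable Mn
mainTheorem18 =
    not-definable invisible (λ _ _ ()) only-¬p₀-p₀-not-symmetric
  , not-definable invisible (λ _ _ ()) only-¬p₀-p₀-not-Mn
  where
  invisible : ⟨ (λ _ → false) , ∅ ⟩ ≡ᴱ ⟨ (λ _ → false) , only-¬p₀-p₀ ⟩
  invisible = adding-¬p₀-p₀-invisible (λ _ → false) refl
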